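{- Let $\mathbb T_{2,2+2}=(W,R_1',R_2')$ be the following 2-frame. Let $T_{2,2}=\{a_1,a_2,b_1,b_2\}^*$ (finite words) with relations $\vec a R_1\vec b$ iff $\vec b=\vec a\cdot\vec c$ for some $\vec c\in\{a_1,a_2\}^*$, and $\vec a R_2\vec b$ iff $\vec b=\vec a\cdot\vec d$ for some $\vec d\in\{b_1,b_2\}^*$ ($\cdot$ is concatenation). Let $T_2=\{1,2\}^*$ with $\sqsubseteq$ the prefix relation and $\varepsilon$ the empty word, and let $\rho$ be a new symbol. Put $W=T_{2,2}\times\{\rho\}\cup T_{2,2}\times T_2$. $R_1'$ is the least reflexive transitive relation on $W$ such that $(\vec a,\rho)R_1'(\vec a',\rho)$ whenever $\vec aR_1\vec a'$, and $(\vec a,\rho)R_1'(\vec a,\varepsilon)$ for all $\vec a$. $R_2'$ is the least reflexive transitive relation on $W$ such that $(\vec a,\rho)R_2'(\vec a',\rho)$ whenever $\vec aR_2\vec a'$, and $(\vec a,\vec b)R_2'(\vec a,\vec b')$ whenever $\vec b,\vec b'\in T_2$ and $\vec b\sqsubseteq\vec b'$. Then the set of bimodal formulas valid in $\mathbb T_{2,2+2}$ equals $\mathsf{L}=\mathsf{S4.1}\ast\mathsf{S4}+\Diamond_1\Box_2(\Diamond_1 p\to\Box_1 p)$.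
   Context: Kripke semantics: $x\models\Box_iA$ iff $A$ holds at all $y$ with $xR_i'y$; $\Diamond_i=\lnot\Box_i\lnot$; validity in a frame means truth at all points under all valuations. $\mathsf{S4}=\mathsf{K}+\Box p\to p+\Box p\to\Box\Box p$, $\mathsf{S4.1}=\mathsf{S4}+\Box\Diamond p\to\Diamond\Box p$; $\mathsf{L}_1\ast\mathsf{L}_2$ is the smallest normal bimodal logic containing $\mathsf{L}_1$ for $\Box_1$ and $\mathsf{L}_2$ for $\Box_2$; $\mathsf{L}+A$ is the smallest normal logic containing $\mathsf{L}$ and $A$. -}

module Defs where

open import Data.Nat using (ℕ)
open import Data.Bool using (Bool)
open import Data.List using (List; []; _++_)
open import Data.List.Relation.Unary.All using (All)
open import Data.Maybe using (Maybe; just; nothing)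
open import Data.Product using (Σ; _×_; _,_)
open import Data.Empty using (⊥)
open import Relation.Binary.PropositionalEquality using (_≡_)
open import Relation.Binary.Construct.Closure.ReflexiveTransitive using (Star)

data Fm : Set where
  var : ℕ → Fm
  ⊥'  : Fm
  _⇒_ : Fm → Fm → Fm
  □₁  : Fm → Fm
  □₂  : Fm → Fm

infixr 5 _⇒_

¬' : Fm → Fm
¬' A = A ⇒ ⊥'

◇₁ : Fm → Fm
◇₁ A = ¬' (□₁ (¬' A))

◇₂ : Fm → Fm
◇₂ A = ¬' (□₂ (¬' A))

-- The logic L = S4.1 * S4 + ◇₁□₂(◇₁p → □₁p)
-- Axioms are given as schemes (equivalent to closure under uniform
-- substitution).

data L : Fm → Set where
  ax-K   : ∀ A B → L (A ⇒ B ⇒ A)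
  ax-S   : ∀ A B C → L ((A ⇒ B ⇒ C) ⇒ (A ⇒ B) ⇒ A ⇒ C)
  ax-DN  : ∀ A → L (¬' (¬' A) ⇒ A)
  K₁     : ∀ A B → L (□₁ (A ⇒ B) ⇒ □₁ A ⇒ □₁ B)
  T₁     : ∀ A → L (□₁ A ⇒ A)
  Four₁  : ∀ A → L (□₁ A ⇒ □₁ (□₁ A))
  M₁     : ∀ A → L (□₁ (◇₁ A) ⇒ ◇₁ (□₁ A))
  K₂     : ∀ A B → L (□₂ (A ⇒ B) ⇒ □₂ A ⇒ □₂ B)
  T₂     : ∀ A → L (□₂ A ⇒ A)
  Four₂  : ∀ A → L (□₂ A ⇒ □₂ (□₂ A))
  extra  : ∀ A → L (◇₁ (□₂ (◇₁ A ⇒ □₁ A)))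
  mp     : ∀ {A B} → L (A ⇒ B) → L A → L B
  nec₁   : ∀ {A} → L A → L (□₁ A)
  nec₂   : ∀ {A} → L A → L (□₂ A)

record Frame : Set₁ where
  field
    W  : Set
    R₁ : W → W → Set
    R₂ : W → W → Set
open Frame public

module _ (F : Frame) where
  _,_⊨_ : (ℕ → W F → Set) → W F → Fm → Set
  V , x ⊨ var n  = V n x
  V , x ⊨ ⊥'     = ⊥
  V , x ⊨ (A ⇒ B) = V , x ⊨ A → V , x ⊨ B
  V , x ⊨ □₁ A   = ∀ y → R₁ F x y → V , y ⊨ A
  V , x ⊨ □₂ A   = ∀ y → R₂ F x y → V , y ⊨ A

  Valid : Fm → Set₁
  Valid A = ∀ (V : ℕ → W F → Set) (x : W F) → V , x ⊨ A

data Letter : Set where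
  a₁ a₂ b₁ b₂ : Letter

data IsA : Letter → Set where
  isa₁ : IsA a₁
  isa₂ : IsA a₂

data IsB : Letter → Set where
  isb₁ : IsB b₁
  isb₂ : IsB b₂

T22 : Set
T22 = List Letter

R1 : T22 → T22 → Set
R1 a b = Σ (List Letter) λ c → All IsA c × (b ≡ a ++ c)

R2 : T22 → T22 → Set
R2 a b = Σ (List Letter) λ d → All IsB d × (b ≡ a ++ d)

T2 : Set
T2 = List Bool

_⊑_ : T2 → T2 → Set
b ⊑ b' = Σ T2 λ c → b' ≡ b ++ c

-- W = T22 × {ρ} ∪ T22 × T2 ; second component nothing = ρ, just b = b
WT : Set
WT = T22 × Maybe T2

data Step₁ : WT → WT → Set where
  s-ρρ : ∀ {a a'} → R1 a a' → Step₁ (a , nothing) (a' , nothing)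
  s-ρε : ∀ {a} → Step₁ (a , nothing) (a , just [])

data Step₂ : WT → WT → Set where
  s-ρρ : ∀ {a a'} → R2 a a' → Step₂ (a , nothing) (a' , nothing)
  s-⊑  : ∀ {a b b'} → b ⊑ b' → Step₂ (a , just b) (a , just b')

R₁' : WT → WT → Set
R₁' = Star Step₁

R₂' : WT → WT → Set
R₂' = Star Step₂

𝕋 : Frame
𝕋 = record { W = WT ; R₁ = R₁' ; R₂ = R₂' }

{-# OPTIONS --safe #-}
-- Every point of 𝕋 R₁'-sees a point of T₂₂ × T₂, where R₁' is only
-- reflexive; there ◇₁p → □₁p holds, and it keeps holding along R₂', which stays
-- inside T₂₂ × T₂.  This validates McKinsey's axiom and ◇₁□₂(◇₁p → □₁p).
--
-- Suppose A ∉ L and let K = ⋀_{B ∈ sub A} (□₁B ∨ □₁¬B).  Label the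
-- points of 𝕋 by atoms: consistent formulas deciding every member of K ∷ sub A.
-- Words are read as programs: a₁ (resp. b₁ and true) moves to an R₁- (resp. R₂-)
-- successor atom refuting, if possible, the first formula of a cyclic queue of
-- sub A, whereas a₂, b₂ and false rotate the queue.  So boxed formulas are carried
-- along R₁' and R₂', and every ¬□ᵢB is witnessed after finitely many rotations.
-- The step (a,ρ) → (a,ε) moves to an atom containing □₂K; this is consistent
-- because ◇₁□₂K ∈ L (McKinsey gives ◇₁K, and the extra axiom upgrades it).  On
-- T₂₂ × T₂, where R₁' is trivial, □₂K makes every B ∈ sub A □₁-stable, so ¬□₁B
-- already forces ¬B.  The truth lemma then refutes A at ([], ρ).
module Submission where

open import Defs
open import Level using (0ℓ)
open import Axiom.ExcludedMiddle using (ExcludedMiddle)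
open import Data.Bool using (Bool; true; false)
open import Data.Empty using (⊥; ⊥-elim)
open import Data.List using (List; []; _∷_; _++_; [_]; _∷ʳ_; map; length; foldl; replicate)
open import Data.List.Properties using (++-assoc; ++-identityʳ)
open import Data.List.Membership.Propositional using (_∈_)
open import Data.List.Membership.Propositional.Properties using (∈-++⁺ˡ; ∈-++⁺ʳ; ∈-∃++)
open import Data.List.Relation.Binary.Subset.Propositional using (_⊆_)
open import Data.List.Relation.Binary.Subset.Propositional.Properties using (⊆-refl)
open import Data.List.Relation.Unary.All using (All; []; _∷_; universal)
open import Data.List.Relation.Unary.All.Properties using (++⁺; replicate⁺)
open import Data.List.Relation.Unary.Any using (here; there)
open import Data.Maybe using (just; nothing)
open import Data.Nat using (ℕ; zero; suc)
open import Data.Nat.GeneralisedArithmetic using (iterate)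
open import Data.Product using (_×_; Σ; ∃; ∃₂; _,_)
open import Data.Sum using (_⊎_; inj₁; inj₂)
open import Data.Unit using (⊤)
open import Function using (id; _∘_; _⇔_; mk⇔; Equivalence)
open import Relation.Nullary using (¬_; yes; no)
open import Relation.Nullary.Decidable using (decidable-stable)
open import Relation.Binary.PropositionalEquality using (_≡_; refl; sym; cong; subst; module ≡-Reasoning)
open import Relation.Binary.Construct.Closure.ReflexiveTransitive using (ε; _◅_; _◅◅_; fold)

private
  variable
    Γ Δ : List Fm
    A B C F : Fm
    T : Set

infix 3 _⊢_
infixl 5 _·_

data _⊢_ (Γ : List Fm) : Fm → Set where
  hyp : A ∈ Γ → Γ ⊢ A
  thm : L A → Γ ⊢ A
  _·_ : Γ ⊢ A ⇒ B → Γ ⊢ A → Γ ⊢ B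

#0 : A ∷ Γ ⊢ A
#0 = hyp (here refl)

#1 : B ∷ A ∷ Γ ⊢ A
#1 = hyp (there (here refl))

#2 : C ∷ B ∷ A ∷ Γ ⊢ A
#2 = hyp (there (there (here refl)))

L-identity : ∀ A → L (A ⇒ A)
L-identity A = mp (mp (ax-S A (A ⇒ A) A) (ax-K A (A ⇒ A))) (ax-K A A)

deduction : A ∷ Γ ⊢ B → Γ ⊢ A ⇒ B
deduction {A} (hyp (here refl)) = thm (L-identity A)
deduction (hyp (there p))      = thm (ax-K _ _) · hyp p
deduction (thm p)              = thm (ax-K _ _) · thm p
deduction (d · e)              = thm (ax-S _ _ _) · deduction d · deduction e

closed : [] ⊢ A → L A
closed (thm p) = p
closed (d · e) = mp (closed d) (closed e)

L-⇒ : [ A ] ⊢ B → L (A ⇒ B)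
L-⇒ d = closed (deduction d)

weaken : Γ ⊆ Δ → Γ ⊢ A → Δ ⊢ A
weaken Γ⊆Δ (hyp p) = hyp (Γ⊆Δ p)
weaken Γ⊆Δ (thm p) = thm p
weaken Γ⊆Δ (d · e) = weaken Γ⊆Δ d · weaken Γ⊆Δ e

wk : Γ ⊢ A → B ∷ Γ ⊢ A
wk = weaken there

by-contradiction : ¬' A ∷ Γ ⊢ ⊥' → Γ ⊢ A
by-contradiction {A} d = thm (ax-DN A) · deduction d

explosion : Γ ⊢ ⊥' → Γ ⊢ A
explosion d = by-contradiction (wk d)

by-cases : A ∷ Γ ⊢ C → ¬' A ∷ Γ ⊢ C → Γ ⊢ C
by-cases d₁ d₂ =
  by-contradiction (#0 · (wk (deduction d₂) · deduction (#1 · (wk (wk (deduction d₁)) · #0))))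

⊤' : Fm
⊤' = ⊥' ⇒ ⊥'

infixr 6 _∧'_ _∨'_

_∧'_ : Fm → Fm → Fm
A ∧' B = ¬' (A ⇒ ¬' B)

_∨'_ : Fm → Fm → Fm
A ∨' B = ¬' A ⇒ B

∧-intro : Γ ⊢ A → Γ ⊢ B → Γ ⊢ A ∧' B
∧-intro a b = deduction (#0 · wk a · wk b)

∧-elimˡ : Γ ⊢ A ∧' B → Γ ⊢ A
∧-elimˡ d = by-contradiction (wk d · deduction (deduction (explosion (#2 · #1))))

∧-elimʳ : Γ ⊢ A ∧' B → Γ ⊢ B
∧-elimʳ d = by-contradiction (wk d · deduction #1)

∨-introˡ : Γ ⊢ A → Γ ⊢ A ∨' B
∨-introˡ a = deduction (explosion (#0 · wk a))

∨-introʳ : Γ ⊢ B → Γ ⊢ A ∨' B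
∨-introʳ b = deduction (wk b)

∨-elim : Γ ⊢ A ∨' B → A ∷ Γ ⊢ C → B ∷ Γ ⊢ C → Γ ⊢ C
∨-elim d d₁ d₂ = by-cases d₁ (wk (deduction d₂) · (wk d · #0))

data Ix : Set where
  one two : Ix

□[_] : Ix → Fm → Fm
□[ one ] = □₁
□[ two ] = □₂

◇[_] : Ix → Fm → Fm
◇[ i ] A = ¬' (□[ i ] (¬' A))

K[_] : ∀ i A B → L (□[ i ] (A ⇒ B) ⇒ □[ i ] A ⇒ □[ i ] B)
K[ one ] = K₁
K[ two ] = K₂

T[_] : ∀ i A → L (□[ i ] A ⇒ A)
T[ one ] = T₁
T[ two ] = T₂

Four[_] : ∀ i A → L (□[ i ] A ⇒ □[ i ] (□[ i ] A))
Four[ one ] = Four₁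
Four[ two ] = Four₂

nec[_] : ∀ i → L A → L (□[ i ] A)
nec[ one ] = nec₁
nec[ two ] = nec₂

□-mp : ∀ i → Γ ⊢ □[ i ] (A ⇒ B) → Γ ⊢ □[ i ] A → Γ ⊢ □[ i ] B
□-mp i f a = thm (K[ i ] _ _) · f · a

□-mono : ∀ i → L (A ⇒ B) → Γ ⊢ □[ i ] A → Γ ⊢ □[ i ] B
□-mono i p = □-mp i (thm (nec[ i ] p))

□-elim : ∀ i → Γ ⊢ □[ i ] A → Γ ⊢ A
□-elim i a = thm (T[ i ] _) · a

□-dup : ∀ i → Γ ⊢ □[ i ] A → Γ ⊢ □[ i ] (□[ i ] A)
□-dup i a = thm (Four[ i ] _) · a

□-∧ : ∀ i → Γ ⊢ □[ i ] A → Γ ⊢ □[ i ] B → Γ ⊢ □[ i ] (A ∧' B)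
□-∧ i a b = □-mp i (□-mono i (L-⇒ (deduction (∧-intro #1 #0))) a) b

◇-mono : ∀ i → L (A ⇒ B) → Γ ⊢ ◇[ i ] A → Γ ⊢ ◇[ i ] B
◇-mono i p d = deduction (wk d · □-mono i (L-⇒ (deduction (#1 · (thm p · #0)))) #0)

□◇-∧ : ∀ i → Γ ⊢ □[ i ] A → Γ ⊢ ◇[ i ] B → Γ ⊢ ◇[ i ] (B ∧' A)
□◇-∧ {A = A} {B = B} i a d = deduction (wk d · □-mp i (□-mono i ¬∧ (wk a)) #0)
  where
  ¬∧ : L (A ⇒ ¬' (B ∧' A) ⇒ ¬' B)
  ¬∧ = L-⇒ (deduction (deduction (#1 · ∧-intro #0 #2)))

◇◇-elim : ∀ i → Γ ⊢ ◇[ i ] (◇[ i ] A) → Γ ⊢ ◇[ i ] A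
◇◇-elim i d = deduction (wk d · □-mono i (L-⇒ (deduction (#0 · #1))) (□-dup i #0))

¬□⇒◇¬ : ∀ i → Γ ⊢ ¬' (□[ i ] A) → Γ ⊢ ◇[ i ] (¬' A)
¬□⇒◇¬ {A = A} i d = deduction (wk d · □-mono i (ax-DN A) #0)

-- The generalised McKinsey formula

Stable : Fm → Fm
Stable B = □₁ B ∨' □₁ (¬' B)

⋀ : List Fm → Fm
⋀ []       = ⊤'
⋀ (A ∷ As) = A ∧' ⋀ As

AllStable : List Fm → Fm
AllStable Fs = ⋀ (map Stable Fs)

AllStable⇒Stable : ∀ {Fs} → B ∈ Fs → L (AllStable Fs ⇒ Stable B)
AllStable⇒Stable (here refl) = L-⇒ (∧-elimˡ #0)
AllStable⇒Stable (there p)   = L-⇒ (thm (AllStable⇒Stable p) · ∧-elimʳ #0)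

-- In the second case the hypothesis ¬ □₁ ◇₁ B is literally the formula ◇₁ □₁ ¬ B.
◇₁-Stable : ∀ B → L (◇₁ (Stable B))
◇₁-Stable B = closed (by-cases (◇-mono one (L-⇒ (∨-introˡ #0)) (thm (M₁ B) · #0))
                               (◇-mono one (L-⇒ (∨-introʳ #0)) #0))

Stable⇒□₁Stable : ∀ B → L (Stable B ⇒ □₁ (Stable B))
Stable⇒□₁Stable B = L-⇒ (∨-elim #0 (□-mono one (L-⇒ (∨-introˡ #0)) (□-dup one #0))
                                    (□-mono one (L-⇒ (∨-introʳ #0)) (□-dup one #0)))

AllStable⇒□₁AllStable : ∀ Fs → L (AllStable Fs ⇒ □₁ (AllStable Fs))
AllStable⇒□₁AllStable []       = L-⇒ (thm (nec₁ (L-identity ⊥')))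
AllStable⇒□₁AllStable (B ∷ Fs) = L-⇒ (□-∧ one (thm (Stable⇒□₁Stable B) · ∧-elimˡ #0)
                                                (thm (AllStable⇒□₁AllStable Fs) · ∧-elimʳ #0))

◇₁-AllStable : ∀ Fs → L (◇₁ (AllStable Fs))
◇₁-AllStable []       = closed (deduction (□-elim one #0 · thm (L-identity ⊥')))
◇₁-AllStable (B ∷ Fs) = closed (◇◇-elim one (◇-mono one
  (L-⇒ (□◇-∧ one (thm (AllStable⇒□₁AllStable Fs) · #0) (thm (◇₁-Stable B))))
  (thm (◇₁-AllStable Fs))))

◇₁□₂-AllStable : ∀ Fs → L (◇₁ (□₂ (AllStable Fs)))
◇₁□₂-AllStable Fs = closed (◇-mono one
  (L-⇒ (□-mono two (L-⇒ (□-elim one (#0 · thm (◇₁-AllStable Fs)))) #0))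
  (thm (extra (AllStable Fs))))

-- Soundness

_⊨⟨_⟩_ : (ℕ → WT → Set) → WT → Fm → Set
V ⊨⟨ x ⟩ A = _,_⊨_ 𝕋 V x A

R₁'-from-T2 : ∀ {a b y} → R₁' (a , just b) y → y ≡ (a , just b)
R₁'-from-T2 ε        = refl
R₁'-from-T2 (() ◅ _)

R₂'-from-T2 : ∀ {a b y} → R₂' (a , just b) y → ∃ λ b' → y ≡ (a , just b')
R₂'-from-T2 {b = b} ε  = b , refl
R₂'-from-T2 (s-⊑ _ ◅ r) = R₂'-from-T2 r

R₁'-reaches-T2 : ∀ x → ∃₂ λ a b → R₁' x (a , just b)
R₁'-reaches-T2 (a , nothing) = a , [] , s-ρε ◅ ε
R₁'-reaches-T2 (a , just b)  = a , b , ε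

module Soundness (em : ExcludedMiddle 0ℓ) where

  ◇₁⇒□₁-at-T2 : ∀ V a b A → V ⊨⟨ (a , just b) ⟩ (◇₁ A ⇒ □₁ A)
  ◇₁⇒□₁-at-T2 V a b A ◇A y r rewrite R₁'-from-T2 r with em {V ⊨⟨ (a , just b) ⟩ A}
  ... | yes holds = holds
  ... | no fails  = ⊥-elim (◇A λ z r' → fails ∘ subst (V ⊨⟨_⟩ A) (R₁'-from-T2 r'))

  □₂[◇₁⇒□₁]-at-T2 : ∀ V a b A → V ⊨⟨ (a , just b) ⟩ □₂ (◇₁ A ⇒ □₁ A)
  □₂[◇₁⇒□₁]-at-T2 V a b A z r with R₂'-from-T2 r
  ... | b' , refl = ◇₁⇒□₁-at-T2 V a b' A

  sound : L A → Valid 𝕋 A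
  sound (ax-K A B) V x a _ = a
  sound (ax-S A B C) V x f g a = f a (g a)
  sound (ax-DN A) V x ¬¬A with em {V ⊨⟨ x ⟩ A}
  ... | yes holds = holds
  ... | no fails  = ⊥-elim (¬¬A fails)
  sound (K₁ A B) V x f g y r = f y r (g y r)
  sound (T₁ A) V x f = f x ε
  sound (Four₁ A) V x f y r z r' = f z (r ◅◅ r')
  sound (M₁ A) V x □◇A □¬□A with R₁'-reaches-T2 x
  ... | a , b , r = □¬□A (a , just b) r (◇₁⇒□₁-at-T2 V a b A (□◇A (a , just b) r))
  sound (K₂ A B) V x f g y r = f y r (g y r)
  sound (T₂ A) V x f = f x ε
  sound (Four₂ A) V x f y r z r' = f z (r ◅◅ r')
  sound (extra A) V x □¬□ with R₁'-reaches-T2 x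
  ... | a , b , r = □¬□ (a , just b) r (□₂[◇₁⇒□₁]-at-T2 V a b A)
  sound (mp d e) V x = sound d V x (sound e V x)
  sound (nec₁ d) V x y _ = sound d V y
  sound (nec₂ d) V x y _ = sound d V y

rotate : List T → List T
rotate []       = []
rotate (x ∷ xs) = xs ∷ʳ x

∈-rotate : ∀ {x : T} {xs} → x ∈ xs → x ∈ rotate xs
∈-rotate {xs = _ ∷ ys} (here p)  = ∈-++⁺ʳ ys (here p)
∈-rotate               (there p) = ∈-++⁺ˡ p

rotate-prefix : ∀ ys (x : T) zs → iterate rotate (ys ++ x ∷ zs) (length ys) ≡ x ∷ zs ++ ys
rotate-prefix []       x zs = cong (x ∷_) (sym (++-identityʳ zs))
rotate-prefix (y ∷ ys) x zs = begin
  iterate rotate ((ys ++ x ∷ zs) ∷ʳ y) (length ys)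
    ≡⟨ cong (λ l → iterate rotate l (length ys)) (++-assoc ys (x ∷ zs) [ y ]) ⟩
  iterate rotate (ys ++ x ∷ (zs ∷ʳ y)) (length ys)
    ≡⟨ rotate-prefix ys x (zs ∷ʳ y) ⟩
  x ∷ (zs ∷ʳ y) ++ ys
    ≡⟨ cong (x ∷_) (++-assoc zs [ y ] ys) ⟩
  x ∷ zs ++ y ∷ ys
    ∎
  where open ≡-Reasoning

rotate-to-front : ∀ {x : T} {xs} → x ∈ xs → ∃₂ λ m ys → iterate rotate xs m ≡ x ∷ ys
rotate-to-front {x = x} x∈xs with ∈-∃++ x∈xs
... | ys , zs , refl = length ys , zs ++ ys , rotate-prefix ys x zs

-- Atoms

Consistent : Fm → Set
Consistent θ = ¬ L (¬' θ)

Decides : Fm → Fm → Set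
Decides θ B = L (θ ⇒ B) ⊎ L (θ ⇒ ¬' B)

Decides-strengthen : ∀ {θ θ'} → L (θ' ⇒ θ) → Decides θ B → Decides θ' B
Decides-strengthen θ'⇒θ (inj₁ θ⇒B)  = inj₁ (L-⇒ (thm θ⇒B · (thm θ'⇒θ · #0)))
Decides-strengthen θ'⇒θ (inj₂ θ⇒¬B) = inj₂ (L-⇒ (thm θ⇒¬B · (thm θ'⇒θ · #0)))

module _ (em : ExcludedMiddle 0ℓ) where

  refine : ∀ {θ} B → Consistent θ → Σ Fm λ θ' → Consistent θ' × L (θ' ⇒ θ) × Decides θ' B
  refine {θ} B con with em {L (¬' (θ ∧' B))}
  ... | no con⁺  = θ ∧' B , con⁺ , L-⇒ (∧-elimˡ #0) , inj₁ (L-⇒ (∧-elimʳ #0))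
  ... | yes inc⁺ = θ ∧' ¬' B , con⁻ , L-⇒ (∧-elimˡ #0) , inj₂ (L-⇒ (∧-elimʳ #0))
    where
    con⁻ : Consistent (θ ∧' ¬' B)
    con⁻ inc⁻ = con (L-⇒ (by-cases (thm inc⁺ · ∧-intro #1 #0) (thm inc⁻ · ∧-intro #1 #0)))

  lindenbaum : ∀ {ψ} Fs → Consistent ψ →
               Σ Fm λ θ → Consistent θ × L (θ ⇒ ψ) × (∀ {B} → B ∈ Fs → Decides θ B)
  lindenbaum {ψ} [] con = ψ , con , L-identity ψ , λ ()
  lindenbaum (B ∷ Fs) con with lindenbaum Fs con
  ... | θ , conθ , θ⇒ψ , decθ with refine B conθ
  ... | θ' , conθ' , θ'⇒θ , decB = θ' , conθ' , L-⇒ (thm θ⇒ψ · (thm θ'⇒θ · #0)) , dec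
    where
    dec : ∀ {F} → F ∈ B ∷ Fs → Decides θ' F
    dec (here refl) = decB
    dec (there p)   = Decides-strengthen θ'⇒θ (decθ p)

  boxed-part : ∀ i θ Fs → Σ Fm λ Q → L (θ ⇒ Q) × L (Q ⇒ □[ i ] Q) ×
               (∀ {F} → F ∈ Fs → L (θ ⇒ □[ i ] F) → L (Q ⇒ □[ i ] F))
  boxed-part i θ [] = ⊤' , L-⇒ (deduction #0) , L-⇒ (thm (nec[ i ] (L-identity ⊥'))) , λ ()
  boxed-part i θ (F ∷ Fs) with boxed-part i θ Fs | em {L (θ ⇒ □[ i ] F)}
  ... | Q , θ⇒Q , Q⇒□Q , Q⇒□ | no θ⇏□F = Q , θ⇒Q , Q⇒□Q , Q⇒□'
    where
    Q⇒□' : ∀ {G} → G ∈ F ∷ Fs → L (θ ⇒ □[ i ] G) → L (Q ⇒ □[ i ] G)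
    Q⇒□' (here refl) θ⇒□F = ⊥-elim (θ⇏□F θ⇒□F)
    Q⇒□' (there p)        = Q⇒□ p
  ... | Q , θ⇒Q , Q⇒□Q , Q⇒□ | yes θ⇒□F =
    □[ i ] F ∧' Q ,
    L-⇒ (∧-intro (thm θ⇒□F · #0) (thm θ⇒Q · #0)) ,
    L-⇒ (□-∧ i (□-dup i (∧-elimˡ #0)) (thm Q⇒□Q · ∧-elimʳ #0)) ,
    Q⇒□'
    where
    Q⇒□' : ∀ {G} → G ∈ F ∷ Fs → L (θ ⇒ □[ i ] G) → L (□[ i ] F ∧' Q ⇒ □[ i ] G)
    Q⇒□' (here refl) _    = L-⇒ (∧-elimˡ #0)
    Q⇒□' (there p) θ⇒□G = L-⇒ (thm (Q⇒□ p θ⇒□G) · ∧-elimʳ #0)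

module Atoms (em : ExcludedMiddle 0ℓ) (Φ : List Fm) where

  record Atom : Set where
    field
      θ          : Fm
      consistent : Consistent θ
      decides    : B ∈ Φ → Decides θ B
  open Atom public

  extend : ∀ ψ → Consistent ψ → Σ Atom λ l → L (θ l ⇒ ψ)
  extend ψ con with lindenbaum em Φ con
  ... | θ , conθ , θ⇒ψ , decθ = record { θ = θ ; consistent = conθ ; decides = decθ } , θ⇒ψ

  no-contradiction : ∀ l → L (θ l ⇒ B) → L (θ l ⇒ ¬' B) → ⊥
  no-contradiction l θ⇒B θ⇒¬B = consistent l (L-⇒ (thm θ⇒¬B · #0 · (thm θ⇒B · #0)))

  record _≼[_]_ (l : Atom) (i : Ix) (l' : Atom) : Set where
    field
      transfer : F ∈ Φ → L (θ l ⇒ □[ i ] F) → L (θ l' ⇒ □[ i ] F)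
  open _≼[_]_ public

  ≼-refl : ∀ {i l} → l ≼[ i ] l
  ≼-refl = record { transfer = λ _ p → p }

  ≼-trans : ∀ {i l l' l''} → l ≼[ i ] l' → l' ≼[ i ] l'' → l ≼[ i ] l''
  ≼-trans l≼l' l'≼l'' = record { transfer = λ F∈Φ → transfer l'≼l'' F∈Φ ∘ transfer l≼l' F∈Φ }

  ◇-witness : ∀ i (l : Atom) E → L (θ l ⇒ ◇[ i ] E) → Σ Atom λ l' → l ≼[ i ] l' × L (θ l' ⇒ E)
  ◇-witness i l E θ⇒◇E with boxed-part em i (θ l) Φ
  ... | Q , θ⇒Q , Q⇒□Q , Q⇒□ with extend (Q ∧' E) con
    where
    con : Consistent (Q ∧' E)
    con inc = consistent l (L-⇒ (thm θ⇒◇E · #0 ·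
      □-mono i (L-⇒ (deduction (thm inc · ∧-intro #1 #0))) (thm Q⇒□Q · (thm θ⇒Q · #0))))
  ... | l' , l'⇒Q∧E = l' , l≼l' , L-⇒ (∧-elimʳ (thm l'⇒Q∧E · #0))
    where
    l≼l' : l ≼[ i ] l'
    l≼l' = record { transfer = λ F∈Φ θ⇒□F →
      L-⇒ (thm (Q⇒□ F∈Φ θ⇒□F) · ∧-elimˡ (thm l'⇒Q∧E · #0)) }

  record Successor (i : Ix) (l : Atom) (E : Fm) : Set where
    field
      next      : Atom
      forth     : l ≼[ i ] next
      witnesses : L (θ l ⇒ ◇[ i ] E) → L (θ next ⇒ E)

  successor : ∀ i l E → Successor i l E
  successor i l E with em {L (θ l ⇒ ◇[ i ] E)}
  ... | yes θ⇒◇E = let l' , l≼l' , l'⇒E = ◇-witness i l E θ⇒◇E in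
    record { next = l' ; forth = l≼l' ; witnesses = λ _ → l'⇒E }
  ... | no θ⇏◇E = record { next = l ; forth = ≼-refl ; witnesses = ⊥-elim ∘ θ⇏◇E }

-- The canonical labelling of 𝕋

sub : Fm → List Fm
sub (var n) = var n ∷ []
sub ⊥'      = ⊥' ∷ []
sub (B ⇒ C) = (B ⇒ C) ∷ sub B ++ sub C
sub (□₁ B)  = □₁ B ∷ sub B
sub (□₂ B)  = □₂ B ∷ sub B

∈-sub : ∀ B → B ∈ sub B
∈-sub (var n) = here refl
∈-sub ⊥'      = here refl
∈-sub (B ⇒ C) = here refl
∈-sub (□₁ B)  = here refl
∈-sub (□₂ B)  = here refl

R[_] : Ix → WT → WT → Set
R[ one ] = R₁'
R[ two ] = R₂'

module Canonical (em : ExcludedMiddle 0ℓ) (S : List Fm) where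

  open Atoms em (AllStable S ∷ S) public
  open Successor

  record State : Set where
    field
      atom   : Atom
      queue  : List Fm
      covers : S ⊆ queue
  open State

  pending : List Fm → Fm
  pending []      = ⊤'
  pending (F ∷ _) = F

  start : Atom → State
  start l = record { atom = l ; queue = S ; covers = ⊆-refl }

  rotate-move : State → State
  rotate-move s = record s { queue = rotate (queue s) ; covers = λ p → ∈-rotate (covers s p) }

  witness-move : Ix → State → State
  witness-move i s = record s { atom = next (successor i (atom s) (¬' (pending (queue s)))) }

  ρ-step : State → Letter → State
  ρ-step s a₁ = witness-move one s
  ρ-step s a₂ = rotate-move s
  ρ-step s b₁ = witness-move two s
  ρ-step s b₂ = rotate-move s

  T-step : State → Bool → State
  T-step s true  = witness-move two s
  T-step s false = rotate-move s

  witness-move-≼ : ∀ i s → atom s ≼[ i ] atom (witness-move i s)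
  witness-move-≼ i s = forth (successor i (atom s) _)

  ρ-step-≼₁ : ∀ {x} s → IsA x → atom s ≼[ one ] atom (ρ-step s x)
  ρ-step-≼₁ s isa₁ = witness-move-≼ one s
  ρ-step-≼₁ s isa₂ = ≼-refl

  ρ-step-≼₂ : ∀ {x} s → IsB x → atom s ≼[ two ] atom (ρ-step s x)
  ρ-step-≼₂ s isb₁ = witness-move-≼ two s
  ρ-step-≼₂ s isb₂ = ≼-refl

  T-step-≼ : ∀ s x → atom s ≼[ two ] atom (T-step s x)
  T-step-≼ s true  = witness-move-≼ two s
  T-step-≼ s false = ≼-refl

  foldl-++-≼ : ∀ {X : Set} i (step : State → X → State) {P : X → Set} →
               (∀ {x} s → P x → atom s ≼[ i ] atom (step s x)) →
               ∀ s xs {ys} → All P ys → atom (foldl step s xs) ≼[ i ] atom (foldl step s (xs ++ ys))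
  foldl-++-≼ i step step-≼ s (x ∷ xs) pys        = foldl-++-≼ i step step-≼ (step s x) xs pys
  foldl-++-≼ i step step-≼ s []       []         = ≼-refl
  foldl-++-≼ i step step-≼ s []       (py ∷ pys) =
    ≼-trans (step-≼ s py) (foldl-++-≼ i step step-≼ _ [] pys)

  witness-move-refutes : ∀ i s → pending (queue s) ≡ B → L (θ (atom s) ⇒ ◇[ i ] (¬' B)) →
                         L (θ (atom (witness-move i s)) ⇒ ¬' B)
  witness-move-refutes i s refl = witnesses (successor i (atom s) _)

  module _ {X : Set} (step : State → X → State) (r w : X) (i : Ix)
           (step-r : ∀ s → step s r ≡ rotate-move s)
           (step-w : ∀ s → step s w ≡ witness-move i s) where

    refute-after-rotations : ∀ m s → pending (iterate rotate (queue s) m) ≡ B →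
                             L (θ (atom s) ⇒ ◇[ i ] (¬' B)) →
                             L (θ (atom (foldl step s (replicate m r ++ [ w ]))) ⇒ ¬' B)
    refute-after-rotations zero    s eq h rewrite step-w s = witness-move-refutes i s eq h
    refute-after-rotations (suc m) s eq h rewrite step-r s =
      refute-after-rotations m (rotate-move s) eq h

    refute : ∀ s xs → B ∈ S → L (θ (atom (foldl step s xs)) ⇒ ¬' (□[ i ] B)) →
             ∃ λ m → L (θ (atom (foldl step s (xs ++ replicate m r ++ [ w ]))) ⇒ ¬' B)
    refute s (x ∷ xs) B∈S h = refute (step s x) xs B∈S h
    refute s []       B∈S h with rotate-to-front (covers s B∈S)
    ... | m , _ , eq = m , refute-after-rotations m s (cong pending eq) (L-⇒ (¬□⇒◇¬ i (thm h · #0)))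

  enter-T2 : (l : Atom) → Successor one l (□₂ (AllStable S))
  enter-T2 l = successor one l (□₂ (AllStable S))

  module _ (root : Atom) where

    ρ-state : T22 → State
    ρ-state = foldl ρ-step (start root)

    T-state : T22 → T2 → State
    T-state a = foldl T-step (start (next (enter-T2 (atom (ρ-state a)))))

    label : WT → Atom
    label (a , nothing) = atom (ρ-state a)
    label (a , just b)  = atom (T-state a b)

    infix 4 _⊩_
    _⊩_ : WT → Fm → Set
    x ⊩ B = L (θ (label x) ⇒ B)

    Step₁-≼ : ∀ {x y} → Step₁ x y → label x ≼[ one ] label y
    Step₁-≼ (s-ρρ {a} (c , c∈A* , refl)) = foldl-++-≼ one ρ-step ρ-step-≼₁ (start root) a c∈A*
    Step₁-≼ (s-ρε {a})                   = forth (enter-T2 (atom (ρ-state a)))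

    Step₂-≼ : ∀ {x y} → Step₂ x y → label x ≼[ two ] label y
    Step₂-≼ (s-ρρ {a} (c , c∈B* , refl)) = foldl-++-≼ two ρ-step ρ-step-≼₂ (start root) a c∈B*
    Step₂-≼ (s-⊑ {a} {b} (c , refl))    =
      foldl-++-≼ two T-step {P = λ _ → ⊤} (λ {x} s _ → T-step-≼ s x) (T-state a []) b (universal _ c)

    R-≼ : ∀ i {x y} → R[ i ] x y → label x ≼[ i ] label y
    R-≼ one = fold (λ x y → label x ≼[ one ] label y) (≼-trans ∘ Step₁-≼) ≼-refl
    R-≼ two = fold (λ x y → label x ≼[ two ] label y) (≼-trans ∘ Step₂-≼) ≼-refl

    T2-zone : ∀ a b → (a , just b) ⊩ □₂ (AllStable S)
    T2-zone a b = transfer (R-≼ two {a , just []} (s-⊑ (b , refl) ◅ ε)) (here refl)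
                    (witnesses (enter-T2 (atom (ρ-state a))) (L-⇒ (thm (◇₁□₂-AllStable S))))

    back : ∀ i x → B ∈ S → x ⊩ ¬' (□[ i ] B) → ∃ λ y → R[ i ] x y × y ⊩ ¬' B
    back one (a , nothing) B∈S h =
      let m , refuted = refute ρ-step a₂ a₁ one (λ _ → refl) (λ _ → refl) (start root) a B∈S h in
      (a ++ replicate m a₂ ++ [ a₁ ] , nothing) ,
      s-ρρ (_ , ++⁺ (replicate⁺ m isa₂) (isa₁ ∷ []) , refl) ◅ ε , refuted
    back {B} one (a , just b) B∈S h = (a , just b) , ε , L-⇒ (□-elim one (stable · (thm h · #0)))
      where
      stable : [ θ (label (a , just b)) ] ⊢ Stable B
      stable = thm (AllStable⇒Stable B∈S) · □-elim two (thm (T2-zone a b) · #0)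
    back two (a , nothing) B∈S h =
      let m , refuted = refute ρ-step b₂ b₁ two (λ _ → refl) (λ _ → refl) (start root) a B∈S h in
      (a ++ replicate m b₂ ++ [ b₁ ] , nothing) ,
      s-ρρ (_ , ++⁺ (replicate⁺ m isb₂) (isb₁ ∷ []) , refl) ◅ ε , refuted
    back two (a , just b) B∈S h =
      let m , refuted = refute T-step false true two (λ _ → refl) (λ _ → refl) (T-state a []) b B∈S h in
      (a , just (b ++ replicate m false ++ [ true ])) , s-⊑ (_ , refl) ◅ ε , refuted

    Val : ℕ → WT → Set
    Val n x = x ⊩ var n

    decides-S : ∀ x → B ∈ S → Decides (θ (label x)) B
    decides-S x B∈S = decides (label x) (there B∈S)

    truth-□ : ∀ i {B} → □[ i ] B ∈ S → B ∈ S → (∀ y → Val ⊨⟨ y ⟩ B ⇔ y ⊩ B) →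
              ∀ x → (∀ y → R[ i ] x y → Val ⊨⟨ y ⟩ B) ⇔ x ⊩ □[ i ] B
    truth-□ i {B} □B∈S B∈S ih x = mk⇔ to from
      where
      to : (∀ y → R[ i ] x y → Val ⊨⟨ y ⟩ B) → x ⊩ □[ i ] B
      to holds with decides-S x □B∈S
      ... | inj₁ x⊩□B  = x⊩□B
      ... | inj₂ x⊩¬□B with back i x B∈S x⊩¬□B
      ... | y , xRy , y⊩¬B =
        ⊥-elim (no-contradiction (label y) (Equivalence.to (ih y) (holds y xRy)) y⊩¬B)
      from : x ⊩ □[ i ] B → ∀ y → R[ i ] x y → Val ⊨⟨ y ⟩ B
      from x⊩□B y xRy = Equivalence.from (ih y)
        (L-⇒ (□-elim i (thm (transfer (R-≼ i xRy) (there B∈S) x⊩□B) · #0)))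

    truth : ∀ B → sub B ⊆ S → ∀ x → Val ⊨⟨ x ⟩ B ⇔ x ⊩ B
    truth (var n) _ x = mk⇔ id id
    truth ⊥'      _ x = mk⇔ ⊥-elim (consistent (label x))
    truth (B ⇒ C) sub⊆S x = mk⇔ to from
      where
      ih-B : Val ⊨⟨ x ⟩ B ⇔ x ⊩ B
      ih-B = truth B (λ p → sub⊆S (there (∈-++⁺ˡ p))) x
      ih-C : Val ⊨⟨ x ⟩ C ⇔ x ⊩ C
      ih-C = truth C (λ p → sub⊆S (there (∈-++⁺ʳ (sub B) p))) x
      to : (Val ⊨⟨ x ⟩ B → Val ⊨⟨ x ⟩ C) → x ⊩ B ⇒ C
      to f with decides-S x (sub⊆S (there (∈-++⁺ˡ (∈-sub B))))
      ... | inj₁ x⊩B  =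
        L-⇒ (deduction (wk (thm (Equivalence.to ih-C (f (Equivalence.from ih-B x⊩B))) · #0)))
      ... | inj₂ x⊩¬B = L-⇒ (deduction (explosion (thm x⊩¬B · #1 · #0)))
      from : x ⊩ B ⇒ C → Val ⊨⟨ x ⟩ B → Val ⊨⟨ x ⟩ C
      from x⊩B⇒C holds =
        Equivalence.from ih-C (L-⇒ (thm x⊩B⇒C · #0 · (thm (Equivalence.to ih-B holds) · #0)))
    truth (□₁ B) sub⊆S =
      truth-□ one (sub⊆S (here refl)) (sub⊆S (there (∈-sub B))) (truth B (sub⊆S ∘ there))
    truth (□₂ B) sub⊆S =
      truth-□ two (sub⊆S (here refl)) (sub⊆S (there (∈-sub B))) (truth B (sub⊆S ∘ there))

  unprovable⇒invalid : sub A ⊆ S → ¬ L A → ¬ Valid 𝕋 A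
  unprovable⇒invalid {A} sub⊆S ⊬A valid with extend (¬' A) (λ ⊢¬¬A → ⊬A (mp (ax-DN A) ⊢¬¬A))
  ... | root , root⇒¬A = no-contradiction root root⇒A root⇒¬A
    where
    root⇒A : L (θ root ⇒ A)
    root⇒A = Equivalence.to (truth root A sub⊆S ([] , nothing)) (valid (Val root) ([] , nothing))

mainTheorem9 : ExcludedMiddle 0ℓ → (A : Fm) → (L A → Valid 𝕋 A) × (Valid 𝕋 A → L A)
mainTheorem9 em A = Soundness.sound em , λ valid →
  decidable-stable em λ ⊬A → Canonical.unprovable⇒invalid em (sub A) ⊆-refl ⊬A valid
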